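{- Let $\varphi$ be an $\mathcal{ALCQIO}_b$-formula over $\tau$ and let $Reach(B_{h'},S_{h'},A_{h'})$, $1\le h'\le h$, be fixed reachability assertions over $\tau$. Then $\mathrm{ORD}'(\varphi)$ is non-empty iff there is a (finite) model $\mathcal M$ of $\varphi$ that has an $h'$-useful labeling for every $1\le h'\le h$.
   Context: Vocabularies contain atomic concepts, atomic roles (a subset $\mathsf{N_F}$ functional, interpreted as partial functions) and nominals; structures are finite. $\mathcal{ALCQIO}_b$ formulae are Boolean combinations of concept inclusions between concepts built from atomic concepts and nominals by $\sqcap,\sqcup,\neg,\exists r.C,\exists^{\le n}r.C$ ($r$ an atomic role or inverse), standard semantics. Reachability assertions $Reach(B_{h'},S_{h'},A_{h'})$ have $A_{h'},B_{h'}$ atomic concepts and $S_{h'}\subseteq\mathsf{N_F}$. For a $\tau$-structure $\mathcal M$, $D_{h'}^{\mathcal M}$ is the directed graph with vertex set $A_{h'}^{\mathcal M}$ and edges $\left(\bigcup_{s\in S_{h'}}s^{\mathcal M}\right)\cap(A_{h'}^{\mathcal M})^2$. $C\in\varphi$ means $C$ is a concept occurring as a side of an inclusion in $\varphi$; let $k=|\{C:C\in\varphi\}|$, so $\mathrm{TYPES}_\varphi$ (the power set of $\{C:C\in\varphi\}$) has $2^k$ elements; the type of $u$ is the set of $C\in\varphi$ containing $u$. A function $f:A_{h'}^{\mathcal M}\to\{1,\dots,2^k\}$ is an $h'$-useful labeling for $\mathcal M$ if (1) equal labels imply equal types and (2) every $u\in A_{h'}^{\mathcal M}\setminus B_{h'}^{\mathcal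 M}$ admits $v,w\in A_{h'}^{\mathcal M}$ with $f(u)=f(v)$, $f(w)<f(v)$ and $(w,v)$ an edge of $D_{h'}^{\mathcal M}$. The extended vocabulary $ext(\tau)$ adds to $\tau$ fresh atomic concepts $\mathsf M,P_1,\dots,P_k$, a fresh nominal $o_{start}$, and fresh functional roles $succ,f_1,\dots,f_h$. For an $ext(\tau)$-structure $\mathcal N$ with universe $N$, let $\mathcal M$ be the $\tau$-substructure with universe $\mathsf M^{\mathcal N}$, $O^{\mathcal N}=N\setminus\mathsf M^{\mathcal N}$, $eval:O^{\mathcal N}\to\{1,\dots,2^k\}$, $eval(u)=1+\sum_{i:u\in P_i^{\mathcal N}}2^{i-1}$, and $(succ^{\mathcal N})^*$ the reflexive-transitive closure of $succ^{\mathcal N}$. Then $\mathcal N\in\mathrm{ORD}'(\varphi)$ iff: (1) $\mathcal M\models\varphi$; (2) $O^{\mathcal N}=\{o_{start}^{\mathcal N}\}\cup\bigcup_{i=1}^kP_i^{\mathcal N}$; (3) $eval$ is a bijection, $eval(o_{start}^{\mathcal N})=1$, and for $u,v\in O^{\mathcal N}$, $succ^{\mathcal N}(u)=v$ iff $eval(u)+1=eval(v)$; (4) each $f_{h'}^{\mathcal N}$ is a function from $A_{h'}^{\mathcal M}$ to $O^{\mathcal N}$; (5) each $f_{h'}^{\mathcal N}$ is an $h'$-useful labeling for $\mathcal M$ when $O^{\mathcal N}$ is used in place of $\{1,\dots,2^k\}$ and $(succ^{\mathcal N})^*$ in place of the order on the numbers. (The paper denotes $\mathrm{ORD}'(\varphi)$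 by $\mathit{ORD}(\varphi)$.) -}

module Defs where

open import Data.Nat using (ℕ; zero; suc; _+_; _^_; _≤_; _<_)
open import Data.Fin using (Fin; toℕ) renaming (zero to fz; suc to fs)
open import Data.Bool using (Bool; true; false; T; not; if_then_else_)
open import Data.Unit using (⊤; tt)
open import Data.Empty using (⊥)
open import Data.Sum using (_⊎_; inj₁; inj₂)
open import Data.Product using (Σ; ∃; _×_; _,_; proj₁; proj₂; ∃-syntax)
open import Data.List using (List; []; _∷_; _++_; length)
open import Data.List.Membership.Propositional using (_∈_)
open import Data.List.Relation.Unary.Unique.Propositional using (Unique)
open import Relation.Nullary using (¬_)
open import Relation.Binary.PropositionalEquality using (_≡_; _≢_; refl; cong)
open import Relation.Binary.Construct.Closure.ReflexiveTransitive using (Star)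
open import Function.Bundles using (_↔_)

-- Vocabularies: atomic concepts CN, atomic roles RN (Fn = functional
-- roles N_F, a subset of RN), nominals NN.

record Vocab : Set₁ where
  field
    CN : Set
    RN : Set
    NN : Set
    Fn : RN → Set

open Vocab public

data Role (τ : Vocab) : Set where
  rl  : RN τ → Role τ
  inv : RN τ → Role τ

data Concept (τ : Vocab) : Set where
  atom   : CN τ → Concept τ
  nomc   : NN τ → Concept τ
  _⊓_    : Concept τ → Concept τ → Concept τ
  _⊔_    : Concept τ → Concept τ → Concept τ
  ¬c     : Concept τ → Concept τ
  exists : Role τ → Concept τ → Concept τ
  atMost : ℕ → Role τ → Concept τ → Concept τ

data Formula (τ : Vocab) : Set where
  incl : Concept τ → Concept τ → Formula τ
  fnot : Formula τ → Formula τ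
  fand : Formula τ → Formula τ → Formula τ
  for  : Formula τ → Formula τ → Formula τ

sides : {τ : Vocab} → Formula τ → List (Concept τ)
sides (incl C D) = C ∷ D ∷ []
sides (fnot φ)   = sides φ
sides (fand φ ψ) = sides φ ++ sides ψ
sides (for φ ψ)  = sides φ ++ sides ψ

NumDistinct : {A : Set} → List A → ℕ → Set
NumDistinct {A} xs k =
  Σ (List A) λ ys → Unique ys × length ys ≡ k
    × (∀ x → x ∈ xs → x ∈ ys) × (∀ x → x ∈ ys → x ∈ xs)

-- Structures (interpretations are Boolean-valued; functional roles are
-- partial functions).  Finiteness is a separate predicate.

record Structure (τ : Vocab) : Set₁ where
  field
    U    : Set
    conc : CN τ → U → Bool
    role : RN τ → U → U → Bool
    nom  : NN τ → U
    functional : ∀ r → Fn τ r → ∀ u v w →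
                 T (role r u v) → T (role r u w) → v ≡ w

open Structure public

Finite : Set → Set
Finite X = ∃[ n ] (X ↔ Fin n)

module _ {τ : Vocab} (M : Structure τ) where

  roleSem : Role τ → U M → U M → Set
  roleSem (rl r)  u v = T (role M r u v)
  roleSem (inv r) u v = T (role M r v u)

  ⟦_⟧ : Concept τ → U M → Set
  ⟦ atom A ⟧       u = T (conc M A u)
  ⟦ nomc o ⟧       u = u ≡ nom M o
  ⟦ C ⊓ D ⟧        u = ⟦ C ⟧ u × ⟦ D ⟧ u
  ⟦ C ⊔ D ⟧        u = ⟦ C ⟧ u ⊎ ⟦ D ⟧ u
  ⟦ ¬c C ⟧         u = ¬ ⟦ C ⟧ u
  ⟦ exists r C ⟧   u = ∃[ v ] (roleSem r u v × ⟦ C ⟧ v)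
  ⟦ atMost n r C ⟧ u = ∃[ xs ] (length xs ≤ n ×
                         (∀ v → roleSem r u v → ⟦ C ⟧ v → v ∈ xs))

  Sat : Formula τ → Set
  Sat (incl C D) = ∀ u → ⟦ C ⟧ u → ⟦ D ⟧ u
  Sat (fnot φ)   = ¬ Sat φ
  Sat (fand φ ψ) = Sat φ × Sat ψ
  Sat (for φ ψ)  = Sat φ ⊎ Sat ψ

  SameType : Formula τ → U M → U M → Set
  SameType φ u v = ∀ C → C ∈ sides φ → (⟦ C ⟧ u → ⟦ C ⟧ v) × (⟦ C ⟧ v → ⟦ C ⟧ u)

record ReachAssertion (τ : Vocab) : Set₁ where
  field
    A : CN τ
    B : CN τ
    S : RN τ → Set
    S⊆F : ∀ r → S r → Fn τ r

open ReachAssertion public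

module _ {τ : Vocab} (M : Structure τ) (φ : Formula τ) (R : ReachAssertion τ) where

  -- (w , v) is an edge of D^M (membership of w, v in A^M is required separately)
  Edge : U M → U M → Set
  Edge w v = ∃[ s ] (S R s × T (role M s w v))

  Useful : {L : Set} → (L → L → Set) → ((u : U M) → T (conc M (A R) u) → L) → Set
  Useful lt f =
      (∀ u v (au : T (conc M (A R) u)) (av : T (conc M (A R) v)) →
         f u au ≡ f v av → SameType M φ u v)
    × (∀ u (au : T (conc M (A R) u)) → ¬ T (conc M (B R) u) →
         ∃[ v ] Σ (T (conc M (A R) v)) λ av → ∃[ w ] Σ (T (conc M (A R) w)) λ aw →
           f u au ≡ f v av × lt (f w aw) (f v av) × Edge w v)

  NumUsefulLabeling : ℕ → Set
  NumUsefulLabeling k =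
    Σ ((u : U M) → T (conc M (A R) u) → ℕ) λ f →
      (∀ u au → 1 ≤ f u au × f u au ≤ 2 ^ k) × Useful _<_ f

data ExtCN (k : ℕ) : Set where
  Mc : ExtCN k
  Pc : Fin k → ExtCN k

data ExtRN (h : ℕ) : Set where
  succR : ExtRN h
  fR    : Fin h → ExtRN h

extFn : {τ : Vocab} {h : ℕ} → RN τ ⊎ ExtRN h → Set
extFn {τ} (inj₁ r) = Fn τ r
extFn     (inj₂ _) = ⊤

-- ext(τ): fresh concepts M, P_1..P_k; fresh nominal o_start;
-- fresh functional roles succ, f_1..f_h
ext : Vocab → ℕ → ℕ → Vocab
ext τ k h = record
  { CN = CN τ ⊎ ExtCN k
  ; RN = RN τ ⊎ ExtRN h
  ; NN = NN τ ⊎ ⊤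
  ; Fn = extFn {τ} {h}
  }

sumFin : (n : ℕ) → (Fin n → ℕ) → ℕ
sumFin zero    f = 0
sumFin (suc n) f = f fz + sumFin n (λ i → f (fs i))

T-irr : ∀ b (x y : T b) → x ≡ y
T-irr true  tt tt = refl

module _ {τ : Vocab} (φ : Formula τ) (k h : ℕ) (R : Fin h → ReachAssertion τ)
         (N : Structure (ext τ k h)) where

  isM : U N → Bool
  isM u = conc N (inj₂ Mc) u

  O : Set
  O = Σ (U N) λ u → T (not (isM u))

  P : Fin k → U N → Set
  P i u = T (conc N (inj₂ (Pc i)) u)

  ostart : U N
  ostart = nom N (inj₂ tt)

  -- eval(u) = 1 + Σ_{i : u ∈ P_i} 2^{i-1}   (Fin k is 0-based)
  eval : U N → ℕ
  eval u = 1 + sumFin k (λ i → if conc N (inj₂ (Pc i)) u then 2 ^ toℕ i else 0)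

  succN : U N → U N → Set
  succN u v = T (role N (inj₂ succR) u v)

  sub : (∀ o → T (isM (nom N (inj₁ o)))) → Structure τ
  sub p = record
    { U = Σ (U N) λ u → T (isM u)
    ; conc = λ c u → conc N (inj₁ c) (proj₁ u)
    ; role = λ r u v → role N (inj₁ r) (proj₁ u) (proj₁ v)
    ; nom = λ o → nom N (inj₁ o) , p o
    ; functional = fun
    }
    where
    fun : ∀ r → Fn τ r → ∀ (u v w : Σ (U N) λ u → T (isM u)) →
          T (role N (inj₁ r) (proj₁ u) (proj₁ v)) →
          T (role N (inj₁ r) (proj₁ u) (proj₁ w)) → v ≡ w
    fun r fr (u , _) (v , pv) (w , pw) x y with functional N (inj₁ r) fr u v w x y
    ... | refl with T-irr (isM v) pv pw
    ... | refl = refl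

  Cond2 : Set
  Cond2 = ∀ u → (T (not (isM u)) → (u ≡ ostart ⊎ ∃[ i ] P i u))
              × ((u ≡ ostart ⊎ ∃[ i ] P i u) → T (not (isM u)))

  Cond3 : Set
  Cond3 = (∀ (x y : O) → eval (proj₁ x) ≡ eval (proj₁ y) → proj₁ x ≡ proj₁ y)
        × (∀ n → 1 ≤ n → n ≤ 2 ^ k → Σ O λ x → eval (proj₁ x) ≡ n)
        × eval ostart ≡ 1
        × (∀ (x y : O) → (succN (proj₁ x) (proj₁ y) → eval (proj₁ x) + 1 ≡ eval (proj₁ y))
                       × (eval (proj₁ x) + 1 ≡ eval (proj₁ y) → succN (proj₁ x) (proj₁ y)))

  succO : O → O → Set
  succO x y = succN (proj₁ x) (proj₁ y)

  Olt : O → O → Set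
  Olt x y = Star succO x y × proj₁ x ≢ proj₁ y

  Cond45 : (p : ∀ o → T (isM (nom N (inj₁ o)))) → Fin h → Set
  Cond45 p i =
    Σ ((u : U (sub p)) → T (conc (sub p) (A (R i)) u) → O) λ lab →
        (∀ u au → T (role N (inj₂ (fR i)) (proj₁ u) (proj₁ (lab u au))))
      × (∀ x y → T (role N (inj₂ (fR i)) x y) →
           Σ (T (isM x)) λ _ → T (conc N (inj₁ (A (R i))) x))
      × Useful (sub p) φ (R i) Olt lab

  ORD' : Set
  ORD' = Σ (∀ o → T (isM (nom N (inj₁ o)))) λ p →
           Sat (sub p) φ × Cond2 × Cond3 × (∀ i → Cond45 p i)

module Submission where

-- Forward: the τ-substructure on M^N is the model, and composing f_h' with eval turns the
-- labelings into numeric ones, since eval is injective on O and grows along succ (so the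
-- strict order given by succ* becomes <).
-- Backward: adjoin to M the nodes Fin 2^k, give node a the binary digits of a as P_i and
-- a ↦ a + 1 as succ, and let f_h' send u to the node of its label. The τ-substructure on
-- M^N is an isomorphic copy of M, and isomorphisms preserve concepts, φ and types.

open import Defs
open import Data.Nat
  using (ℕ; zero; suc; _+_; _*_; _^_; _∸_; _≤_; _<_; z≤n; s≤s; s<s⁻¹; ⌊_/2⌋; _≡ᵇ_)
open import Data.Nat.Properties
open import Data.Fin using (Fin; toℕ; fromℕ<) renaming (zero to fz; suc to fs)
open import Data.Fin.Properties using (toℕ-injective; toℕ-fromℕ<; toℕ<n; any?; +↔⊎; 0↔⊥; 1↔⊤)
open import Data.Bool using (Bool; true; false; T; not; if_then_else_; _∧_)
open import Data.Bool.Properties using (T?; T-∧)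
open import Data.Unit using (tt)
open import Data.Empty using (⊥-elim)
open import Data.Sum using (_⊎_; inj₁; inj₂)
open import Data.Sum.Properties using (inj₂-injective)
open import Data.Sum.Function.Propositional using (_⊎-↔_; _⊎-⇔_)
open import Data.Product using (Σ; ∃-syntax; _×_; _,_; proj₁; proj₂)
open import Data.Product.Function.NonDependent.Propositional using (_×-⇔_)
open import Data.Product.Function.Dependent.Propositional using (Σ-↔; Σ-⇔)
open import Data.List using (map; length)
open import Data.List.Properties using (length-map)
open import Data.List.Membership.Propositional using (_∈_)
open import Data.List.Membership.Propositional.Properties using (∈-map⁺)
open import Function using (_∘_)
open import Function.Bundles using (_⇔_; mk⇔; mk↔ₛ′; _↔_; Inverse; Equivalence)
open import Function.Properties.Inverse using (↔-trans; ↔-sym; ↔-refl; ↔⇒↠)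
open import Function.Related.TypeIsomorphisms using (¬-cong-⇔)
open import Relation.Nullary using (¬_; yes; no)
open import Relation.Binary.PropositionalEquality
open import Relation.Binary.Construct.Closure.ReflexiveTransitive using (Star; ε; _◅_; gmap)

sumFin-cong : ∀ n {f g : Fin n → ℕ} → (∀ i → f i ≡ g i) → sumFin n f ≡ sumFin n g
sumFin-cong zero    f≗g = refl
sumFin-cong (suc n) f≗g = cong₂ _+_ (f≗g fz) (sumFin-cong n (f≗g ∘ fs))

sumFin-*ˡ : ∀ n m (f : Fin n → ℕ) → sumFin n (λ i → m * f i) ≡ m * sumFin n f
sumFin-*ˡ zero    m f = sym (*-zeroʳ m)
sumFin-*ˡ (suc n) m f = trans (cong (m * f fz +_) (sumFin-*ˡ n m (f ∘ fs)))
                              (sym (*-distribˡ-+ m (f fz) _))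

bitValue : Bool → ℕ
bitValue b = if b then 1 else 0

bitValue≤1 : ∀ b → bitValue b ≤ 1
bitValue≤1 true  = s≤s z≤n
bitValue≤1 false = z≤n

bitValue-¬T : ∀ {b} → ¬ T b → bitValue b ≡ 0
bitValue-¬T {true}  ¬b = ⊥-elim (¬b tt)
bitValue-¬T {false} ¬b = refl

-- eval u is definitionally 1 + binaryValue k (λ i → conc N (inj₂ (Pc i)) u)
binaryValue : (k : ℕ) → (Fin k → Bool) → ℕ
binaryValue k c = sumFin k (λ i → if c i then 2 ^ toℕ i else 0)

binaryValue-suc : ∀ k c → binaryValue (suc k) c ≡ bitValue (c fz) + 2 * binaryValue k (c ∘ fs)
binaryValue-suc k c = cong (bitValue (c fz) +_)
  (trans (sumFin-cong k (λ i → if-2* (c (fs i)))) (sumFin-*ˡ k 2 _))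
  where
  if-2* : ∀ b {x} → (if b then 2 * x else 0) ≡ 2 * (if b then x else 0)
  if-2* true  = refl
  if-2* false = refl

binaryValue<2^k : ∀ k c → binaryValue k c < 2 ^ k
binaryValue<2^k zero    c = s≤s z≤n
binaryValue<2^k (suc k) c = begin-strict
  binaryValue (suc k) c       ≡⟨ binaryValue-suc k c ⟩
  bitValue (c fz) + 2 * rest  ≤⟨ +-monoˡ-≤ (2 * rest) (bitValue≤1 (c fz)) ⟩
  1 + 2 * rest                <⟨ n<1+n _ ⟩
  2 + 2 * rest                ≡⟨ *-suc 2 rest ⟨
  2 * suc rest                ≤⟨ *-monoʳ-≤ 2 (binaryValue<2^k k (c ∘ fs)) ⟩
  2 * 2 ^ k                   ∎
  where
  open ≤-Reasoning
  rest = binaryValue k (c ∘ fs)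

binaryValue-≡0 : ∀ k c → (∀ i → ¬ T (c i)) → binaryValue k c ≡ 0
binaryValue-≡0 zero    c none = refl
binaryValue-≡0 (suc k) c none = trans (binaryValue-suc k c)
  (cong₂ _+_ (bitValue-¬T (none fz)) (cong (2 *_) (binaryValue-≡0 k (c ∘ fs) (none ∘ fs))))

odd : ℕ → Bool
odd zero          = false
odd (suc zero)    = true
odd (suc (suc n)) = odd n

odd+2*⌊n/2⌋≡n : ∀ n → bitValue (odd n) + 2 * ⌊ n /2⌋ ≡ n
odd+2*⌊n/2⌋≡n zero          = refl
odd+2*⌊n/2⌋≡n (suc zero)    = refl
odd+2*⌊n/2⌋≡n (suc (suc n)) = begin
  b + 2 * suc ⌊ n /2⌋        ≡⟨ cong (b +_) (*-suc 2 ⌊ n /2⌋) ⟩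
  b + suc (suc (2 * ⌊ n /2⌋)) ≡⟨ trans (+-suc b _) (cong suc (+-suc b _)) ⟩
  suc (suc (b + 2 * ⌊ n /2⌋)) ≡⟨ cong (suc ∘ suc) (odd+2*⌊n/2⌋≡n n) ⟩
  suc (suc n)                 ∎
  where
  open ≡-Reasoning
  b = bitValue (odd n)

⌊n/2⌋<m : ∀ n m → n < 2 * m → ⌊ n /2⌋ < m
⌊n/2⌋<m n m n<2m = *-cancelˡ-< 2 ⌊ n /2⌋ m (begin-strict
  2 * ⌊ n /2⌋                       ≤⟨ m≤n+m _ (bitValue (odd n)) ⟩
  bitValue (odd n) + 2 * ⌊ n /2⌋    ≡⟨ odd+2*⌊n/2⌋≡n n ⟩
  n                                 <⟨ n<2m ⟩
  2 * m                             ∎)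
  where open ≤-Reasoning

binaryDigit : ℕ → ℕ → Bool
binaryDigit n zero    = odd n
binaryDigit n (suc i) = binaryDigit ⌊ n /2⌋ i

binaryValue-binaryDigit : ∀ k n → n < 2 ^ k → binaryValue k (λ i → binaryDigit n (toℕ i)) ≡ n
binaryValue-binaryDigit zero    zero    _           = refl
binaryValue-binaryDigit zero    (suc n) (s≤s ())
binaryValue-binaryDigit (suc k) n n<2^k = begin
  binaryValue (suc k) (λ i → binaryDigit n (toℕ i))
    ≡⟨ binaryValue-suc k (λ i → binaryDigit n (toℕ i)) ⟩
  bitValue (odd n) + 2 * binaryValue k (λ i → binaryDigit ⌊ n /2⌋ (toℕ i))
    ≡⟨ cong (λ m → bitValue (odd n) + 2 * m) (binaryValue-binaryDigit k ⌊ n /2⌋ (⌊n/2⌋<m n _ n<2^k)) ⟩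
  bitValue (odd n) + 2 * ⌊ n /2⌋
    ≡⟨ odd+2*⌊n/2⌋≡n n ⟩
  n ∎
  where open ≡-Reasoning

suc-toℕ-onto : ∀ {K n} → 1 ≤ n → n ≤ K → ∃[ j ] suc (toℕ {K} j) ≡ n
suc-toℕ-onto {n = suc m} _ m<K = fromℕ< m<K , cong suc (toℕ-fromℕ< m<K)

≤⇒Star-successor : ∀ {K} {a b : Fin K} → toℕ a ≤ toℕ b →
                   Star (λ x y → suc (toℕ x) ≡ toℕ y) a b
≤⇒Star-successor {K} {a} {b} a≤b = walk (toℕ b ∸ toℕ a) (m+[n∸m]≡n a≤b)
  where
  walk : ∀ d {x} → toℕ x + d ≡ toℕ b → Star (λ x y → suc (toℕ x) ≡ toℕ y) x b
  walk zero {x} x≡b = subst (Star _ x) (toℕ-injective (trans (sym (+-identityʳ _)) x≡b)) ε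
  walk (suc d) {x} x+d≡b =
    sym (toℕ-fromℕ< x+1<K) ◅ walk d (trans (cong (_+ d) (toℕ-fromℕ< x+1<K)) x+1+d≡b)
    where
    x+1+d≡b : suc (toℕ x) + d ≡ toℕ b
    x+1+d≡b = trans (sym (+-suc (toℕ x) d)) x+d≡b
    x+1<K : suc (toℕ x) < K
    x+1<K = ≤-<-trans (≤-trans (m≤m+n _ d) (≤-reflexive x+1+d≡b)) (toℕ<n b)

Σ-T-≡ : ∀ {X : Set} (b : X → Bool) {x y : Σ X (T ∘ b)} → proj₁ x ≡ proj₁ y → x ≡ y
Σ-T-≡ b {x , bx} {.x , by} refl = cong (x ,_) (T-irr (b x) bx by)

Σ-Fin-suc-↔ : ∀ {n} {P : Fin (suc n) → Set} → Σ (Fin (suc n)) P ↔ (P fz ⊎ Σ (Fin n) (P ∘ fs))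
Σ-Fin-suc-↔ = mk↔ₛ′
  (λ { (fz , p) → inj₁ p ; (fs i , p) → inj₂ (i , p) })
  (λ { (inj₁ p) → fz , p ; (inj₂ (i , p)) → fs i , p })
  (λ { (inj₁ p) → refl ; (inj₂ (i , p)) → refl })
  (λ { (fz , p) → refl ; (fs i , p) → refl })

T↔Fin-bitValue : ∀ b → T b ↔ Fin (bitValue b)
T↔Fin-bitValue true  = ↔-sym 1↔⊤
T↔Fin-bitValue false = ↔-sym 0↔⊥

Finite-Σ-Fin : ∀ n (b : Fin n → Bool) → Finite (Σ (Fin n) (T ∘ b))
Finite-Σ-Fin zero    b = 0 , mk↔ₛ′ (λ ()) (λ ()) (λ ()) (λ ())
Finite-Σ-Fin (suc n) b =
  let m , Σ↔m = Finite-Σ-Fin n (b ∘ fs) in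
  bitValue (b fz) + m , ↔-trans Σ-Fin-suc-↔ (↔-trans (T↔Fin-bitValue (b fz) ⊎-↔ Σ↔m) (↔-sym +↔⊎))

Finite-Σ-T : ∀ {X : Set} (b : X → Bool) → Finite X → Finite (Σ X (T ∘ b))
Finite-Σ-T b (n , X↔n) =
  let m , Σ↔m = Finite-Σ-Fin n (b ∘ Inverse.from X↔n) in
  m , ↔-trans (↔-sym (Σ-↔ (↔-sym X↔n) ↔-refl)) Σ↔m

record _≅_ {τ : Vocab} (M M′ : Structure τ) : Set where
  field
    bijection : U M ↔ U M′
  open Inverse bijection public using (to; from; strictlyInverseˡ; strictlyInverseʳ)
  field
    conc-to : ∀ c u → conc M′ c (to u) ≡ conc M c u
    role-to : ∀ r u v → role M′ r (to u) (to v) ≡ role M r u v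
    nom-to  : ∀ o → nom M′ o ≡ to (nom M o)

module _ {τ : Vocab} {M M′ : Structure τ} (M≅M′ : M ≅ M′) where
  open _≅_ M≅M′

  private
    T-≡-⇔ : ∀ {b b′} → b ≡ b′ → T b ⇔ T b′
    T-≡-⇔ refl = mk⇔ (λ x → x) (λ x → x)

    via-from : ∀ (P : U M′ → Set) {v′} → P v′ → P (to (from v′))
    via-from P {v′} = subst P (sym (strictlyInverseˡ v′))

  roleSem-≅ : ∀ r {u v} → roleSem M r u v ⇔ roleSem M′ r (to u) (to v)
  roleSem-≅ (rl r)  {u} {v} = T-≡-⇔ (sym (role-to r u v))
  roleSem-≅ (inv r) {u} {v} = T-≡-⇔ (sym (role-to r v u))

  ⟦⟧-≅ : ∀ C u → ⟦_⟧ M C u ⇔ ⟦_⟧ M′ C (to u)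
  ⟦⟧-≅ (atom c)       u = T-≡-⇔ (sym (conc-to c u))
  ⟦⟧-≅ (nomc o)       u = mk⇔
    (λ u≡o → trans (cong to u≡o) (sym (nom-to o)))
    (λ u≡o → trans (sym (strictlyInverseʳ u))
               (trans (cong from (trans u≡o (nom-to o))) (strictlyInverseʳ (nom M o))))
  ⟦⟧-≅ (C ⊓ D)        u = ⟦⟧-≅ C u ×-⇔ ⟦⟧-≅ D u
  ⟦⟧-≅ (C ⊔ D)        u = ⟦⟧-≅ C u ⊎-⇔ ⟦⟧-≅ D u
  ⟦⟧-≅ (¬c C)         u = ¬-cong-⇔ (⟦⟧-≅ C u)
  ⟦⟧-≅ (exists r C)   u = Σ-⇔ (↔⇒↠ bijection) (roleSem-≅ r ×-⇔ ⟦⟧-≅ C _)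
  ⟦⟧-≅ (atMost n r C) u = mk⇔
    (λ (xs , ∣xs∣≤n , covers) → map to xs , ≤-trans (≤-reflexive (length-map to xs)) ∣xs∣≤n ,
       λ v′ rv′ Cv′ → subst (_∈ map to xs) (strictlyInverseˡ v′) (∈-map⁺ to (covers (from v′)
         (Equivalence.from (roleSem-≅ r) (via-from (roleSem M′ r (to u)) rv′))
         (Equivalence.from (⟦⟧-≅ C (from v′)) (via-from (⟦_⟧ M′ C) Cv′)))))
    (λ (ys , ∣ys∣≤n , covers) → map from ys , ≤-trans (≤-reflexive (length-map from ys)) ∣ys∣≤n ,
       λ v rv Cv → subst (_∈ map from ys) (strictlyInverseʳ v) (∈-map⁺ from (covers (to v)
         (Equivalence.to (roleSem-≅ r) rv) (Equivalence.to (⟦⟧-≅ C v) Cv))))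

  Sat-≅ : ∀ ψ → Sat M ψ ⇔ Sat M′ ψ
  Sat-≅ (incl C D) = mk⇔
    (λ C⊑D u′ Cu′ → subst (⟦_⟧ M′ D) (strictlyInverseˡ u′) (Equivalence.to (⟦⟧-≅ D (from u′))
       (C⊑D (from u′) (Equivalence.from (⟦⟧-≅ C (from u′)) (via-from (⟦_⟧ M′ C) Cu′)))))
    (λ C⊑D u Cu → Equivalence.from (⟦⟧-≅ D u) (C⊑D (to u) (Equivalence.to (⟦⟧-≅ C u) Cu)))
  Sat-≅ (fnot ψ)   = ¬-cong-⇔ (Sat-≅ ψ)
  Sat-≅ (fand ψ χ) = Sat-≅ ψ ×-⇔ Sat-≅ χ
  Sat-≅ (for ψ χ)  = Sat-≅ ψ ⊎-⇔ Sat-≅ χ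

  SameType-≅ : ∀ φ {u v} → SameType M φ u v → SameType M′ φ (to u) (to v)
  SameType-≅ φ {u} {v} same C C∈φ =
    let u⇒v , v⇒u = same C C∈φ in
    (λ Cu → Equivalence.to (⟦⟧-≅ C v) (u⇒v (Equivalence.from (⟦⟧-≅ C u) Cu))) ,
    (λ Cv → Equivalence.to (⟦⟧-≅ C u) (v⇒u (Equivalence.from (⟦⟧-≅ C v) Cv)))

module _ {τ : Vocab} {M : Structure τ} {φ : Formula τ} {R : ReachAssertion τ} where

  Useful-relabel :
    ∀ {L L′ : Set} {lt : L → L → Set} {lt′ : L′ → L′ → Set}
      {f : (u : U M) → T (conc M (A R) u) → L} {g : (u : U M) → T (conc M (A R) u) → L′} →
    (∀ {u v au av} → g u au ≡ g v av → f u au ≡ f v av) →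
    (∀ {u v au av} → f u au ≡ f v av → g u au ≡ g v av) →
    (∀ {u v au av} → lt (f u au) (f v av) → lt′ (g u au) (g v av)) →
    Useful M φ R lt f → Useful M φ R lt′ g
  Useful-relabel g-reflects f-preserves lt⇒lt′ (same , reaches) =
    (λ u v au av gu≡gv → same u v au av (g-reflects gu≡gv)) ,
    (λ u au ¬Bu → let v , av , w , aw , fu≡fv , fw<fv , edge = reaches u au ¬Bu in
       v , av , w , aw , f-preserves fu≡fv , lt⇒lt′ fw<fv , edge)

module OrdToModel {τ : Vocab} (φ : Formula τ) (k h : ℕ) (R : Fin h → ReachAssertion τ)
                  (N : Structure (ext τ k h)) (cond3 : Cond3 φ k h R N) where

  private
    ev : O φ k h R N → ℕ
    ev = eval φ k h R N ∘ proj₁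

  eval-≤ : ∀ u → eval φ k h R N u ≤ 2 ^ k
  eval-≤ u = binaryValue<2^k k (λ i → conc N (inj₂ (Pc i)) u)

  eval-injective : ∀ {x y} → ev x ≡ ev y → x ≡ y
  eval-injective {x} {y} = Σ-T-≡ (not ∘ isM φ k h R N) ∘ proj₁ cond3 x y

  succ*-≤ : ∀ {x y} → Star (succO φ k h R N) x y → ev x ≤ ev y
  succ*-≤ ε = ≤-refl
  succ*-≤ {x} (_◅_ {j = y} x→y y⇝z) =
    ≤-trans (m≤m+n (ev x) 1) (≤-trans (≤-reflexive (succ⇒+1 x→y)) (succ*-≤ y⇝z))
    where succ⇒+1 = proj₁ (proj₂ (proj₂ (proj₂ cond3)) x y)

  eval-Olt : ∀ {x y} → Olt φ k h R N x y → ev x < ev y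
  eval-Olt {x} {y} (x⇝y , x≢y) = ≤∧≢⇒< (succ*-≤ x⇝y) (x≢y ∘ cong proj₁ ∘ eval-injective {x} {y})

  model : (inM : ∀ o → T (isM φ k h R N (nom N (inj₁ o)))) →
          Sat (sub φ k h R N inM) φ → (∀ i → Cond45 φ k h R N inM i) → Finite (U N) →
          Σ (Structure τ) λ M → Finite (U M) × Sat M φ × (∀ i → NumUsefulLabeling M φ (R i) k)
  model inM sat labelings fin =
    sub φ k h R N inM , Finite-Σ-T (isM φ k h R N) fin , sat , numLabeling
    where
    numLabeling : ∀ i → NumUsefulLabeling (sub φ k h R N inM) φ (R i) k
    numLabeling i = let lab , _ , _ , useful = labelings i in
      (λ u au → ev (lab u au)) , (λ u au → s≤s z≤n , eval-≤ (proj₁ (lab u au))) ,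
      Useful-relabel {φ = φ} {R = R i} {lt = Olt φ k h R N} {lt′ = _<_}
                     eval-injective (cong ev) eval-Olt useful

extendBy0 : (b : Bool) → (T b → ℕ) → ℕ
extendBy0 true  g = g tt
extendBy0 false g = 0

extendBy0-T : ∀ {b} (g : T b → ℕ) (x : T b) → extendBy0 b g ≡ g x
extendBy0-T {true} g tt = refl

module ModelToOrd {τ : Vocab} (φ : Formula τ) (k h : ℕ) (R : Fin h → ReachAssertion τ)
                  (M : Structure τ) (labelings : ∀ i → NumUsefulLabeling M φ (R i) k) where

  K : ℕ
  K = 2 ^ k

  label : ∀ i (u : U M) → T (conc M (A (R i)) u) → ℕ
  label i = proj₁ (labelings i)

  startIndex : Fin K
  startIndex = fromℕ< (m^n>0 2 k)

  -- M^N is a copy of M; the order O^N is a copy of Fin K, node a having eval value suc (toℕ a)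
  concN : CN τ ⊎ ExtCN k → U M ⊎ Fin K → Bool
  concN (inj₁ c)      (inj₁ u) = conc M c u
  concN (inj₂ Mc)     (inj₁ u) = true
  concN (inj₂ (Pc i)) (inj₂ a) = binaryDigit (toℕ a) (toℕ i)
  concN _             _        = false

  roleN : RN τ ⊎ ExtRN h → U M ⊎ Fin K → U M ⊎ Fin K → Bool
  roleN (inj₁ r)      (inj₁ u) (inj₁ v) = role M r u v
  roleN (inj₂ succR)  (inj₂ a) (inj₂ b) = suc (toℕ a) ≡ᵇ toℕ b
  roleN (inj₂ (fR i)) (inj₁ u) (inj₂ a) =
    conc M (A (R i)) u ∧ (extendBy0 (conc M (A (R i)) u) (label i u) ≡ᵇ suc (toℕ a))
  roleN _             _        _        = false

  fR-target : ∀ i {u a} → T (roleN (inj₂ (fR i)) (inj₁ u) (inj₂ a)) →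
              extendBy0 (conc M (A (R i)) u) (label i u) ≡ suc (toℕ a)
  fR-target i {u} r = ≡ᵇ⇒≡ _ _ (proj₂ (Equivalence.to (T-∧ {conc M (A (R i)) u}) r))

  roleN-functional : ∀ r → extFn {τ} {h} r → ∀ u v w → T (roleN r u v) → T (roleN r u w) → v ≡ w
  roleN-functional (inj₁ r) fr (inj₁ u) (inj₁ v) (inj₁ w) uv uw = cong inj₁ (functional M r fr u v w uv uw)
  roleN-functional (inj₂ succR) _ (inj₂ a) (inj₂ b) (inj₂ c) ab ac =
    cong inj₂ (toℕ-injective (trans (sym (≡ᵇ⇒≡ (suc (toℕ a)) _ ab)) (≡ᵇ⇒≡ (suc (toℕ a)) _ ac)))
  roleN-functional (inj₂ (fR i)) _ (inj₁ u) (inj₂ a) (inj₂ b) ua ub =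
    cong inj₂ (toℕ-injective (suc-injective (trans (sym (fR-target i ua)) (fR-target i ub))))
  roleN-functional (inj₁ r)      _ (inj₁ u) (inj₁ v) (inj₂ w) _  ()
  roleN-functional (inj₁ r)      _ (inj₁ u) (inj₂ v) w        () _
  roleN-functional (inj₁ r)      _ (inj₂ u) v        w        () _
  roleN-functional (inj₂ succR)  _ (inj₂ a) (inj₂ b) (inj₁ w) _  ()
  roleN-functional (inj₂ succR)  _ (inj₂ a) (inj₁ v) w        () _
  roleN-functional (inj₂ succR)  _ (inj₁ u) v        w        () _
  roleN-functional (inj₂ (fR i)) _ (inj₁ u) (inj₂ a) (inj₁ w) _  ()
  roleN-functional (inj₂ (fR i)) _ (inj₁ u) (inj₁ v) w        () _
  roleN-functional (inj₂ (fR i)) _ (inj₂ u) v        w        () _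

  N : Structure (ext τ k h)
  N = record
    { U          = U M ⊎ Fin K
    ; conc       = concN
    ; role       = roleN
    ; nom        = λ { (inj₁ o) → inj₁ (nom M o) ; (inj₂ tt) → inj₂ startIndex }
    ; functional = roleN-functional
    }

  inM : ∀ o → T (isM φ k h R N (nom N (inj₁ o)))
  inM o = tt

  SM : Structure τ
  SM = sub φ k h R N inM

  embed : U M → U SM
  embed u = inj₁ u , tt

  M≅SM : M ≅ SM
  M≅SM = record
    { bijection = mk↔ₛ′ embed unembed embed∘unembed (λ _ → refl)
    ; conc-to   = λ _ _ → refl
    ; role-to   = λ _ _ _ → refl
    ; nom-to    = λ _ → refl
    }
    where
    unembed : U SM → U M
    unembed (inj₁ u , _)  = u
    unembed (inj₂ _ , ())
    embed∘unembed : ∀ u → embed (unembed u) ≡ u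
    embed∘unembed (inj₁ u , tt) = refl
    embed∘unembed (inj₂ _ , ())

  liftLabel : ∀ {L : Set} (ρ : ReachAssertion τ) → ((u : U M) → T (conc M (A ρ) u) → L) →
              (u : U SM) → T (conc SM (A ρ) u) → L
  liftLabel ρ g (inj₁ u , _)  au = g u au
  liftLabel ρ g (inj₂ _ , ()) au

  Useful-liftLabel : ∀ {L : Set} {lt : L → L → Set} (ρ : ReachAssertion τ) {g} →
                     Useful M φ ρ lt g → Useful SM φ ρ lt (liftLabel ρ g)
  Useful-liftLabel ρ (same , reaches) =
    (λ { (inj₁ u , tt) (inj₁ v , tt) au av gu≡gv → SameType-≅ M≅SM φ (same u v au av gu≡gv)
       ; (inj₁ _ , _) (inj₂ _ , ()) _ _ _
       ; (inj₂ _ , ()) _ _ _ _ }) ,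
    (λ { (inj₁ u , tt) au ¬Bu → let v , av , w , aw , gu≡gv , lt , edge = reaches u au ¬Bu in
           embed v , av , embed w , aw , gu≡gv , lt , edge
       ; (inj₂ _ , ()) _ _ })

  node : Fin K → O φ k h R N
  node a = inj₂ a , tt

  ev : U N → ℕ
  ev = eval φ k h R N

  eval-node : ∀ a → ev (inj₂ a) ≡ suc (toℕ a)
  eval-node a = cong suc (binaryValue-binaryDigit k (toℕ a) (toℕ<n a))

  start-or-digit : ∀ a → inj₂ a ≡ ostart φ k h R N ⊎ ∃[ i ] P φ k h R N i (inj₂ a)
  start-or-digit a with any? (λ i → T? (binaryDigit (toℕ a) (toℕ i)))
  ... | yes bitSet = inj₂ bitSet
  ... | no  noBit  = inj₁ (cong inj₂ (toℕ-injective (trans a≡0 (sym (toℕ-fromℕ< (m^n>0 2 k))))))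
    where
    a≡0 : toℕ a ≡ 0
    a≡0 = trans (sym (binaryValue-binaryDigit k (toℕ a) (toℕ<n a)))
                (binaryValue-≡0 k _ (λ i bitᵢ → noBit (i , bitᵢ)))

  cond2 : Cond2 φ k h R N
  cond2 (inj₁ u) = (λ ()) , λ { (inj₁ ()) ; (inj₂ (_ , ())) }
  cond2 (inj₂ a) = (λ _ → start-or-digit a) , (λ _ → tt)

  eval-injective : ∀ (x y : O φ k h R N) → ev (proj₁ x) ≡ ev (proj₁ y) → proj₁ x ≡ proj₁ y
  eval-injective (inj₂ a , _)  (inj₂ b , _)  ea≡eb =
    cong inj₂ (toℕ-injective (suc-injective (trans (sym (eval-node a)) (trans ea≡eb (eval-node b)))))
  eval-injective (inj₁ _ , ()) _             _
  eval-injective (inj₂ _ , _)  (inj₁ _ , ()) _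

  eval-onto : ∀ n → 1 ≤ n → n ≤ K → Σ (O φ k h R N) λ x → ev (proj₁ x) ≡ n
  eval-onto n 1≤n n≤K = let a , a+1≡n = suc-toℕ-onto 1≤n n≤K in node a , trans (eval-node a) a+1≡n

  node-succ⇔+1 : ∀ a b → T (suc (toℕ a) ≡ᵇ toℕ b) ⇔ (ev (inj₂ a) + 1 ≡ ev (inj₂ b))
  node-succ⇔+1 a b = mk⇔
    (λ a→b → begin
      ev (inj₂ a) + 1   ≡⟨ cong (_+ 1) (eval-node a) ⟩
      suc (toℕ a) + 1   ≡⟨ +-comm (suc (toℕ a)) 1 ⟩
      suc (suc (toℕ a)) ≡⟨ cong suc (≡ᵇ⇒≡ (suc (toℕ a)) _ a→b) ⟩
      suc (toℕ b)       ≡⟨ eval-node b ⟨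
      ev (inj₂ b)       ∎)
    (λ a+1≡b → ≡⇒≡ᵇ _ _ (suc-injective (begin
      suc (suc (toℕ a)) ≡⟨ +-comm 1 (suc (toℕ a)) ⟩
      suc (toℕ a) + 1   ≡⟨ cong (_+ 1) (eval-node a) ⟨
      ev (inj₂ a) + 1   ≡⟨ a+1≡b ⟩
      ev (inj₂ b)       ≡⟨ eval-node b ⟩
      suc (toℕ b)       ∎)))
    where open ≡-Reasoning

  succ⇔+1 : ∀ (x y : O φ k h R N) → (succO φ k h R N x y → ev (proj₁ x) + 1 ≡ ev (proj₁ y))
                                   × (ev (proj₁ x) + 1 ≡ ev (proj₁ y) → succO φ k h R N x y)
  succ⇔+1 (inj₂ a , _)  (inj₂ b , _)  =
    Equivalence.to (node-succ⇔+1 a b) , Equivalence.from (node-succ⇔+1 a b)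
  succ⇔+1 (inj₁ _ , ()) _
  succ⇔+1 (inj₂ _ , _)  (inj₁ _ , ())

  cond3 : Cond3 φ k h R N
  cond3 = eval-injective , eval-onto , trans (eval-node startIndex) (cong suc (toℕ-fromℕ< _)) , succ⇔+1

  node-Olt : ∀ {a b} → toℕ a < toℕ b → Olt φ k h R N (node a) (node b)
  node-Olt {a} {b} a<b =
    gmap node (λ {x} {y} → ≡⇒≡ᵇ (suc (toℕ x)) (toℕ y)) (≤⇒Star-successor (<⇒≤ a<b)) ,
    λ a≡b → <-irrefl (cong toℕ (inj₂-injective a≡b)) a<b

  indexLabel : ∀ i u (au : T (conc M (A (R i)) u)) → ∃[ a ] suc (toℕ {K} a) ≡ label i u au
  indexLabel i u au = let 1≤ℓ , ℓ≤K = proj₁ (proj₂ (labelings i)) u au in suc-toℕ-onto 1≤ℓ ℓ≤K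

  nodeLabel : ∀ i (u : U M) → T (conc M (A (R i)) u) → O φ k h R N
  nodeLabel i u au = node (proj₁ (indexLabel i u au))

  Useful-nodeLabel : ∀ i → Useful M φ (R i) (Olt φ k h R N) (nodeLabel i)
  Useful-nodeLabel i =
    Useful-relabel {φ = φ} {R = R i} {lt = _<_} {lt′ = Olt φ k h R N}
                   reflects preserves ordered (proj₂ (proj₂ (labelings i)))
    where
    value : ∀ u au → suc (toℕ (proj₁ (indexLabel i u au))) ≡ label i u au
    value u au = proj₂ (indexLabel i u au)

    reflects : ∀ {u v au av} → nodeLabel i u au ≡ nodeLabel i v av → label i u au ≡ label i v av
    reflects {u} {v} {au} {av} e = begin
      label i u au                          ≡⟨ value u au ⟨
      suc (toℕ (proj₁ (indexLabel i u au))) ≡⟨ eval-node _ ⟨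
      ev (proj₁ (nodeLabel i u au))         ≡⟨ cong (ev ∘ proj₁) e ⟩
      ev (proj₁ (nodeLabel i v av))         ≡⟨ eval-node _ ⟩
      suc (toℕ (proj₁ (indexLabel i v av))) ≡⟨ value v av ⟩
      label i v av                          ∎
      where open ≡-Reasoning

    preserves : ∀ {u v au av} → label i u au ≡ label i v av → nodeLabel i u au ≡ nodeLabel i v av
    preserves {u} {v} {au} {av} e =
      cong node (toℕ-injective (suc-injective (trans (value u au) (trans e (sym (value v av))))))

    ordered : ∀ {u v au av} → label i u au < label i v av →
              Olt φ k h R N (nodeLabel i u au) (nodeLabel i v av)
    ordered {u} {v} {au} {av} lt = node-Olt (s<s⁻¹ (subst₂ _<_ (sym (value u au)) (sym (value v av)) lt))

  labelled : ∀ i u au → T (roleN (inj₂ (fR i)) (proj₁ u) (proj₁ (liftLabel (R i) (nodeLabel i) u au)))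
  labelled i (inj₁ u , tt) au = Equivalence.from T-∧
    (au , ≡⇒≡ᵇ _ _ (trans (extendBy0-T (label i u) au) (sym (proj₂ (indexLabel i u au)))))
  labelled i (inj₂ _ , ()) _

  fR-source : ∀ i u v → T (roleN (inj₂ (fR i)) u v) →
              Σ (T (isM φ k h R N u)) λ _ → T (concN (inj₁ (A (R i))) u)
  fR-source i (inj₁ u) (inj₂ a) r = tt , proj₁ (Equivalence.to T-∧ r)
  fR-source i (inj₁ u) (inj₁ v) ()
  fR-source i (inj₂ a) v        ()

  cond45 : ∀ i → Cond45 φ k h R N inM i
  cond45 i = liftLabel (R i) (nodeLabel i) , labelled i , fR-source i ,
             Useful-liftLabel {lt = Olt φ k h R N} (R i) (Useful-nodeLabel i)

  ord : Finite (U M) → Sat M φ → Σ (Structure (ext τ k h)) λ N → Finite (U N) × ORD' φ k h R N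
  ord (m , M↔m) sat = N , (m + K , ↔-trans (M↔m ⊎-↔ ↔-refl) (↔-sym +↔⊎)) ,
                      inM , Equivalence.to (Sat-≅ M≅SM φ) sat , cond2 , cond3 , cond45

lemma11 : (τ : Vocab) (φ : Formula τ) (k : ℕ) → NumDistinct (sides φ) k →
    (h : ℕ) (R : Fin h → ReachAssertion τ) →
    (Σ (Structure (ext τ k h)) λ N → Finite (U N) × ORD' φ k h R N)
    ⇔ (Σ (Structure τ) λ M → Finite (U M) × Sat M φ ×
         (∀ i → NumUsefulLabeling M φ (R i) k))
lemma11 τ φ k _ h R = mk⇔
  (λ (N , fin , inM , sat , _ , cond3 , labelings) →
     OrdToModel.model φ k h R N cond3 inM sat labelings fin)
  (λ (M , fin , sat , labelings) → ModelToOrd.ord φ k h R M labelings fin sat)
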